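{- Let $H$ be a bipartite graph and let $\mathbb{D}=\{\mathcal{D}_i\}_{i=1}^k$ be a set of walks in $H$ of equal length $\ell\ge1$, where $\mathcal{D}_i$ is an $s_i$-$t_i$-walk. Let $A,B$ be a partition of $\mathbb{D}$ into two non-empty sets, and for $C\in\{A,B\}$ let $S(C)=\{s_i:\mathcal{D}_i\in C\}$ and $T(C)=\{t_i:\mathcal{D}_i\in C\}$. Suppose $S(A)\cap S(B)=\emptyset$, $T(A)\cap T(B)=\emptyset$, and every walk in $A$ avoids every walk in $B$. Let $P(\mathbb{D})$ be the path $p_1,\dots,p_{\ell+1}$ with lists $L(p_j)=\{j\text{ -th vertex of }\mathcal{D}_i : i\in[k]\}$, with input vertex $x=p_1$ and output vertex $y=p_{\ell+1}$. Then: (a) $L(x)=S(A)\cup S(B)$ and $L(y)=T(A)\cup T(B)$; (b) for every $i\in[k]$ there is a list homomorphism $f_i:(P(\mathbb{D}),L)\to H$ with $f_i(x)=s_i$ and $f_i(y)=t_i$; (c) for every list homomorphism $f:(P(\mathbb{D}),L)\to H$, if $f(x)\in S(A)$ then $f(y)\notin T(B)$. Furthermore, if also every walk in $B$ avoids every walk in $A$, then (d) for every list homomorphism $f:(P(\mathbb{D}),L)\to H$, if $f(x)\in S(B)$ then $f(y)\notin T(A)$.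
   Context: A walk is a sequence $p_1,\dots,p_\ell$ of vertices with $p_jp_{j+1}\in E(H)$; its length is $\ell-1$; it is an $a$-$b$-walk if $p_1=a$, $p_\ell=b$. For walks $\mathcal{P}=p_1,\dots,p_\ell$ and $\mathcal{Q}=q_1,\dots,q_\ell$ of equal length with $p_1,q_1$ in the same bipartition class, $\mathcal{P}$ avoids $\mathcal{Q}$ if $p_1\ne q_1$ and $p_jq_{j+1}\notin E(H)$ for every $j\in[\ell-1]$. A list homomorphism $(P,L)\to H$ is an edge-preserving map $f:V(P)\to V(H)$ with $f(v)\in L(v)$ for all $v$. -}

module Defs where

open import Data.Nat using (ℕ; suc)
open import Data.Fin using (Fin; zero; suc; inject₁; fromℕ)
open import Data.Bool using (Bool; true; false)
open import Data.Product using (Σ; _×_; ∃; ∃-syntax)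
open import Data.Sum using (_⊎_)
open import Relation.Binary.PropositionalEquality using (_≡_; _≢_)
open import Relation.Nullary using (¬_)
open import Function.Bundles using (_⇔_)

record BipGraph : Set₁ where
  field
    n      : ℕ
    E      : Fin n → Fin n → Set
    E-sym  : ∀ {u v} → E u v → E v u
    colour : Fin n → Bool
    E-bip  : ∀ {u v} → E u v → colour u ≢ colour v

  V : Set
  V = Fin n

open BipGraph public

IsWalk : (H : BipGraph) (ℓ : ℕ) → (Fin (suc ℓ) → V H) → Set
IsWalk H ℓ p = ∀ (j : Fin ℓ) → E H (p (inject₁ j)) (p (suc j))

record Walk (H : BipGraph) (ℓ : ℕ) : Set where
  constructor walk
  field
    vtx    : Fin (suc ℓ) → V H
    isWalk : IsWalk H ℓ vtx

open Walk public

first : ∀ {H ℓ} → Walk H ℓ → V H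
first w = vtx w zero

last : ∀ {H ℓ} → Walk H ℓ → V H
last {ℓ = ℓ} w = vtx w (fromℕ ℓ)

Avoids : ∀ {H ℓ} → Walk H ℓ → Walk H ℓ → Set
Avoids {H} {ℓ} P Q =
  (colour H (first P) ≡ colour H (first Q)) ×
  (first P ≢ first Q) ×
  (∀ (j : Fin ℓ) → ¬ E H (vtx P (inject₁ j)) (vtx Q (suc j)))

-- The family 𝔻 = {D_i}, i ∈ [k], and the partition into A (side i ≡ true)
-- and B (side i ≡ false).
module _ {H : BipGraph} {k ℓ : ℕ} (D : Fin k → Walk H ℓ) (side : Fin k → Bool) where

  S : Bool → V H → Set
  S C v = ∃[ i ] (side i ≡ C × first (D i) ≡ v)

  T : Bool → V H → Set
  T C v = ∃[ i ] (side i ≡ C × last (D i) ≡ v)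

module _ {H : BipGraph} {k ℓ : ℕ} (D : Fin k → Walk H ℓ) where

  L : Fin (suc ℓ) → V H → Set
  L j v = ∃[ i ] (vtx (D i) j ≡ v)

  xP : Fin (suc ℓ)
  xP = zero

  yP : Fin (suc ℓ)
  yP = fromℕ ℓ

  IsListHom : (Fin (suc ℓ) → V H) → Set
  IsListHom f = (∀ j → L j (f j)) ×
                (∀ (j : Fin ℓ) → E H (f (inject₁ j)) (f (suc j)))

-- A list homomorphism f that starts in S(A) never leaves the A-walks: if
-- f(p_j) is the j-th vertex of an A-walk, then f(p_{j+1}) ∈ L(p_{j+1}) is the
-- (j+1)-th vertex of some walk, and that walk cannot lie in B, because the
-- j-th vertex of an A-walk is not adjacent to the (j+1)-th vertex of a
-- B-walk. Hence f(y) ∈ T(A), which is disjoint from T(B).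
module Submission where

open import Defs
open import Data.Nat using (ℕ; suc; _≤_)
open import Data.Fin using (Fin; suc; inject₁)
open import Data.Fin.Induction using (<-weakInduction)
open import Data.Bool using (Bool; true; false; not; _≟_)
open import Data.Bool.Properties using (¬-not)
open import Data.Empty using (⊥-elim)
open import Data.Product using (Σ; _×_; ∃; ∃-syntax; _,_; proj₂)
open import Data.Sum using (_⊎_; inj₁; inj₂)
open import Relation.Binary.PropositionalEquality using (_≡_; refl; sym; subst₂)
open import Relation.Nullary using (¬_; yes; no)
open import Function.Bundles using (_⇔_; mk⇔)

module _ {k : ℕ} (side : Fin k → Bool) where

  ∃-splitBySide : (P : Fin k → Set) →
    (∃[ i ] P i) ⇔ (∃[ i ] (side i ≡ true × P i) ⊎ ∃[ i ] (side i ≡ false × P i))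
  ∃-splitBySide P = mk⇔ split merge
    where
    split : ∃[ i ] P i → ∃[ i ] (side i ≡ true × P i) ⊎ ∃[ i ] (side i ≡ false × P i)
    split (i , p) with side i in eq
    ... | true  = inj₁ (i , eq , p)
    ... | false = inj₂ (i , eq , p)

    merge : ∃[ i ] (side i ≡ true × P i) ⊎ ∃[ i ] (side i ≡ false × P i) → ∃[ i ] P i
    merge (inj₁ (i , _ , p)) = i , p
    merge (inj₂ (i , _ , p)) = i , p

module _ {H : BipGraph} {k ℓ : ℕ} (D : Fin k → Walk H ℓ) (side : Fin k → Bool) where

  OnSide : Bool → (Fin (suc ℓ) → V H) → Fin (suc ℓ) → Set
  OnSide c f j = ∃[ i ] (side i ≡ c × vtx (D i) j ≡ f j)

  NoCrossingEdges : Bool → Set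
  NoCrossingEdges c = ∀ i m (j : Fin ℓ) → side i ≡ c → side m ≡ not c →
    ¬ E H (vtx (D i) (inject₁ j)) (vtx (D m) (suc j))

  avoids⇒noCrossingEdges : ∀ c →
    (∀ i m → side i ≡ c → side m ≡ not c → Avoids (D i) (D m)) →
    NoCrossingEdges c
  avoids⇒noCrossingEdges c avoids i m j si sm = proj₂ (proj₂ (avoids i m si sm)) j

  listHom-staysOnSide : ∀ c → NoCrossingEdges c →
    ∀ f → IsListHom D f → S D side c (f (xP D)) → ∀ j → OnSide c f j
  listHom-staysOnSide c noCross f (inList , edge) startOnSide =
    <-weakInduction (OnSide c f) startOnSide step
    where
    step : ∀ j → OnSide c f (inject₁ j) → OnSide c f (suc j)
    step j (i , si , ei) with inList (suc j)
    ... | m , em with side m ≟ c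
    ...   | yes sm = m , sm , em
    ...   | no  sm≢c =
      ⊥-elim (noCross i m j si (¬-not sm≢c) (subst₂ (E H) (sym ei) (sym em) (edge j)))

  listHom-endsOnSide : ∀ c → NoCrossingEdges c →
    (∀ v → ¬ (T D side c v × T D side (not c) v)) →
    ∀ f → IsListHom D f → S D side c (f (xP D)) → ¬ T D side (not c) (f (yP D))
  listHom-endsOnSide c noCross disjointT f hom startOnSide endOpposite =
    disjointT (f (yP D)) (listHom-staysOnSide c noCross f hom startOnSide (yP D) , endOpposite)

mainTheorem15 :
    (H : BipGraph) (k ℓ : ℕ) → 1 ≤ ℓ →
    (D : Fin k → Walk H ℓ) (side : Fin k → Bool) →
    (∃[ i ] (side i ≡ true)) → (∃[ i ] (side i ≡ false)) →
    (∀ v → ¬ (S D side true v × S D side false v)) →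
    (∀ v → ¬ (T D side true v × T D side false v)) →
    (∀ i j → side i ≡ true → side j ≡ false → Avoids (D i) (D j)) →
    ((∀ v → L D (xP D) v ⇔ (S D side true v ⊎ S D side false v)) ×
     (∀ v → L D (yP D) v ⇔ (T D side true v ⊎ T D side false v))) ×
    (∀ i → Σ (Fin (suc ℓ) → V H) λ f →
       IsListHom D f × f (xP D) ≡ first (D i) × f (yP D) ≡ last (D i)) ×
    (∀ (f : Fin (suc ℓ) → V H) → IsListHom D f →
       S D side true (f (xP D)) → ¬ T D side false (f (yP D))) ×
    ((∀ i j → side i ≡ false → side j ≡ true → Avoids (D i) (D j)) →
     ∀ (f : Fin (suc ℓ) → V H) → IsListHom D f →
       S D side false (f (xP D)) → ¬ T D side true (f (yP D)))
mainTheorem15 H k ℓ _ D side _ _ _ disjointT avoidsAB =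
  ( (λ v → ∃-splitBySide side (λ i → vtx (D i) (xP D) ≡ v))
  , (λ v → ∃-splitBySide side (λ i → vtx (D i) (yP D) ≡ v)) )
  , (λ i → vtx (D i) , ((λ j → i , refl) , isWalk (D i)) , refl , refl)
  , listHom-endsOnSide D side true (avoids⇒noCrossingEdges D side true avoidsAB) disjointT
  , λ avoidsBA → listHom-endsOnSide D side false
      (avoids⇒noCrossingEdges D side false avoidsBA) (λ v (tB , tA) → disjointT v (tA , tB))
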